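{- Let $G=(V,E)$ be an undirected graph with $|V|=n$. Fix any $\alpha \geq 1$, $d \geq 0$, $\epsilon \in (0,1)$, and $L = 2 + \lceil \log_{(1+\epsilon)} n \rceil$. Let $d^*= \max_{S \subseteq V} \rho(S)$, and let $(Z_1, \ldots, Z_L)$ be an $(\alpha, d, L)$-decomposition of $G$. Then: 1. If $d > 2 (1+\epsilon)d^*$, then $Z_L = \emptyset$. 2. Else if $d < d^*/\alpha$, then $Z_L \ne \emptyset$ and there is an index $j \in \{1, \ldots, L-1\}$ such that $\rho(Z_j) \geq d/(2(1+\epsilon))$.
   Context: For nonempty $S\subseteq V$, $\rho(S)=|E(S)|/|S|$, where $E(S)$ is the set of edges with both endpoints in $S$. For $v\in V$ and $S\subseteq V$, $D_v(S)$ denotes the number of neighbors of $v$ lying in $S$. Given $\alpha\ge1$, $d\ge0$ and a positive integer $L$, a tuple $(Z_1,\dots,Z_L)$ of subsets with $Z_1\supseteq Z_2\supseteq\cdots\supseteq Z_L$ is an $(\alpha,d,L)$-decomposition of $G$ iff $Z_1=V$ and for every $i\in\{1,\dots,L-1\}$: $Z_{i+1}\supseteq\{v\in Z_i: D_v(Z_i)>\alpha d\}$ and $Z_{i+1}\cap\{v\in Z_i: D_v(Z_i)<d\}=\emptyset$.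
   Formalization: The parameters α, d and ε take rational values. -}

module Defs where

open import Data.Bool using (Bool; true; false; _∧_; if_then_else_)
open import Data.Nat as ℕ using (ℕ; zero; suc; _<ᵇ_)
open import Data.Fin using (Fin; toℕ) renaming (zero to fzero; suc to fsuc)
open import Data.Fin.Subset using (Subset; _∈_; _∉_; _⊆_; ⊤; ∣_∣)
open import Data.Vec using (lookup)
open import Data.Integer using (+_)
open import Data.Rational using (ℚ; _/_; _*_; _+_; _<_; _≤_; 0ℚ; 1ℚ)
open import Data.Product using (_×_; ∃)
open import Relation.Binary.PropositionalEquality using (_≡_)

record Graph (n : ℕ) : Set where
  field
    adj     : Fin n → Fin n → Bool
    adj-sym : ∀ u v → adj u v ≡ adj v u
    adj-irr : ∀ v → adj v v ≡ false
open Graph public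

b2n : Bool → ℕ
b2n true  = 1
b2n false = 0

sumFin : (n : ℕ) → (Fin n → ℕ) → ℕ
sumFin zero    f = 0
sumFin (suc n) f = f fzero ℕ.+ sumFin n (λ i → f (fsuc i))

memb : ∀ {n} → Subset n → Fin n → Bool
memb S v = lookup S v

edgeCount : ∀ {n} → Graph n → Subset n → ℕ
edgeCount {n} G S =
  sumFin n (λ u → sumFin n (λ v →
    b2n ((toℕ u <ᵇ toℕ v) ∧ adj G u v ∧ memb S u ∧ memb S v)))

degIn : ∀ {n} → Graph n → Fin n → Subset n → ℕ
degIn {n} G v S = sumFin n (λ u → b2n (adj G v u ∧ memb S u))

-- a / b as a rational, with the (unused) convention a / 0 = 0
ratio : ℕ → ℕ → ℚ
ratio a zero    = 0ℚ
ratio a (suc k) = (+ a) / suc k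

ρ : ∀ {n} → Graph n → Subset n → ℚ
ρ G S = ratio (edgeCount G S) ∣ S ∣

IsMaxDensity : ∀ {n} → Graph n → ℚ → Set
IsMaxDensity {n} G dstar =
  (∃ λ (S : Subset n) → (∃ λ v → v ∈ S) × ρ G S ≡ dstar)
  × (∀ (S : Subset n) → (∃ λ v → v ∈ S) → ρ G S ≤ dstar)

_^ℚ_ : ℚ → ℕ → ℚ
q ^ℚ zero  = 1ℚ
q ^ℚ suc k = q * (q ^ℚ k)

-- k = ⌈ log_b n ⌉ (for b > 1, n ≥ 1): least k with n ≤ b^k
IsCeilLog : ℚ → ℕ → ℕ → Set
IsCeilLog b n k =
  ((+ n) / 1 ≤ b ^ℚ k) × (∀ j → j ℕ.< k → b ^ℚ j < (+ n) / 1)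

-- (α,d,L)-decomposition, with Z indexed by ℕ and only Z 1 … Z L relevant
IsDecomposition : ∀ {n} → Graph n → ℚ → ℚ → ℕ → (ℕ → Subset n) → Set
IsDecomposition {n} G α d L Z =
  (Z 1 ≡ ⊤)
  × (∀ i → 1 ℕ.≤ i → i ℕ.< L → Z (suc i) ⊆ Z i)
  × (∀ i → 1 ℕ.≤ i → i ℕ.< L → ∀ (v : Fin n) → v ∈ Z i →
       α * d < (+ degIn G v (Z i)) / 1 → v ∈ Z (suc i))
  × (∀ i → 1 ℕ.≤ i → i ℕ.< L → ∀ (v : Fin n) → v ∈ Z i →
       (+ degIn G v (Z i)) / 1 < d → v ∉ Z (suc i))

-- A vertex that survives a peeling step has at least d neighbours in the previous level, so
-- d |Z_{i+1}| ≤ 2 |E(Z_i)| = 2 ρ(Z_i) |Z_i|.  Hence a level of density below d / (2(1+ε)) is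
-- followed by one that is smaller by a factor 1+ε, and if all L−1 steps are of this kind then
-- |Z_L| ≤ n / (1+ε)^(L−1) < 1.  When d > 2(1+ε)d* every level is that sparse, so Z_L = ∅.
-- Conversely, a densest subgraph S has minimum degree at least d*, since deleting a vertex
-- cannot raise the density; when αd < d* no vertex of S is ever peeled, so S ⊆ Z_L ≠ ∅, and
-- then not every level can be sparse.

module Submission where

open import Defs
open import Data.Nat as ℕ using (ℕ; suc)
open import Data.Fin.Subset using (Subset; ⊥; Nonempty)
open import Data.Rational using (ℚ; _*_; _+_; _<_; _≤_; 0ℚ; 1ℚ)
open import Data.Product using (_×_; ∃)
open import Relation.Binary.PropositionalEquality using (_≡_)

open import Data.Bool using (true; false; _∧_; not)
open import Data.Bool.Properties using (∧-identityʳ; ∧-comm; T-≡; ¬-not)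
open import Data.Nat using (zero; _<ᵇ_; z≤n; s≤s)
import Data.Nat.Properties as ℕₚ
open import Data.Fin using (Fin; toℕ) renaming (zero to fzero; suc to fsuc)
open import Data.Fin.Properties using (toℕ-injective)
open import Data.Fin.Subset using (⊤; ⁅_⁆; _∩_; ∁; _∈_; _∉_; _⊆_; ∣_∣; inside; outside)
open import Data.Fin.Subset.Properties using (∈⊤; ∉⊥; ∣⊤∣≡n; nonempty?; Empty-unique; ∣⊥∣≡0; ∣⁅x⁆∣≡1; x∈⁅y⁆⇒x≡y)
open import Data.Vec using ([]; _∷_)
open import Data.Vec.Properties using (lookup-replicate; lookup-zipWith; lookup-map; []=⇒lookup; lookup⇒[]=)
open import Data.Product using (_,_; proj₂)
open import Relation.Binary.PropositionalEquality using (refl; sym; trans; cong; cong₂; subst; subst₂; module ≡-Reasoning)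
open import Relation.Nullary using (yes; no)
open import Relation.Nullary.Negation using (¬_; contradiction)
open import Relation.Binary.Definitions using (tri<; tri≈; tri>)
open import Function using (_∘_; Equivalence)
open import Data.Nat.Tactic.RingSolver using (solve-∀)
import Data.Integer as ℤ
import Data.Integer.Properties as ℤₚ
open import Data.Rational using (_/_; -_; toℚᵘ; nonNegative; positive)
import Data.Rational.Properties as ℚₚ
open import Data.Rational.Properties using (toℚᵘ-injective; toℚᵘ-fromℚᵘ; toℚᵘ-homo-+; toℚᵘ-homo-*; nonNegative⁻¹; positive⁻¹; normalize-nonNeg; normalize-pos)
import Data.Rational.Unnormalised as ℚᵘ
open import Data.Rational.Unnormalised using (mkℚᵘ)
import Data.Rational.Unnormalised.Properties as ℚᵘ
open import Algebra.Properties.Semiring.Sum ℕₚ.+-*-semiring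
  using (sum; sum-cong-≗; ∑-distrib-+; ∑-comm; *-distribˡ-sum; sum-replicate-zero)

sumFin≡sum : ∀ n (f : Fin n → ℕ) → sumFin n f ≡ sum f
sumFin≡sum zero    f = refl
sumFin≡sum (suc n) f = cong (f fzero ℕ.+_) (sumFin≡sum n (λ i → f (fsuc i)))

sumFin-cong : ∀ n {f g : Fin n → ℕ} → (∀ i → f i ≡ g i) → sumFin n f ≡ sumFin n g
sumFin-cong n {f} {g} f≗g = begin
  sumFin n f  ≡⟨ sumFin≡sum n f ⟩
  sum f       ≡⟨ sum-cong-≗ f≗g ⟩
  sum g       ≡⟨ sumFin≡sum n g ⟨
  sumFin n g  ∎
  where open ≡-Reasoning

sumFin-distrib-+ : ∀ n (f g : Fin n → ℕ) → sumFin n (λ i → f i ℕ.+ g i) ≡ sumFin n f ℕ.+ sumFin n g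
sumFin-distrib-+ n f g = begin
  sumFin n (λ i → f i ℕ.+ g i)  ≡⟨ sumFin≡sum n _ ⟩
  sum (λ i → f i ℕ.+ g i)       ≡⟨ ∑-distrib-+ f g ⟩
  sum f ℕ.+ sum g               ≡⟨ cong₂ ℕ._+_ (sumFin≡sum n f) (sumFin≡sum n g) ⟨
  sumFin n f ℕ.+ sumFin n g     ∎
  where open ≡-Reasoning

sumFin-comm : ∀ n (f : Fin n → Fin n → ℕ) →
  sumFin n (λ i → sumFin n (f i)) ≡ sumFin n (λ j → sumFin n (λ i → f i j))
sumFin-comm n f = begin
  sumFin n (λ i → sumFin n (f i))           ≡⟨ sumFin-cong n (λ i → sumFin≡sum n (f i)) ⟩
  sumFin n (λ i → sum (f i))                ≡⟨ sumFin≡sum n _ ⟩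
  sum (λ i → sum (f i))                     ≡⟨ ∑-comm f ⟩
  sum (λ j → sum (λ i → f i j))             ≡⟨ sumFin≡sum n _ ⟨
  sumFin n (λ j → sum (λ i → f i j))        ≡⟨ sumFin-cong n (λ j → sumFin≡sum n _) ⟨
  sumFin n (λ j → sumFin n (λ i → f i j))   ∎
  where open ≡-Reasoning

*-distribˡ-sumFin : ∀ n c (f : Fin n → ℕ) → c ℕ.* sumFin n f ≡ sumFin n (λ i → c ℕ.* f i)
*-distribˡ-sumFin n c f = begin
  c ℕ.* sumFin n f             ≡⟨ cong (c ℕ.*_) (sumFin≡sum n f) ⟩
  c ℕ.* sum f                  ≡⟨ *-distribˡ-sum c f ⟩
  sum (λ i → c ℕ.* f i)        ≡⟨ sumFin≡sum n _ ⟨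
  sumFin n (λ i → c ℕ.* f i)   ∎
  where open ≡-Reasoning

sumFin-zero : ∀ n → sumFin n (λ _ → 0) ≡ 0
sumFin-zero n = trans (sumFin≡sum n _) (sum-replicate-zero n)

sumFin-mono-≤ : ∀ n {f g : Fin n → ℕ} → (∀ i → f i ℕ.≤ g i) → sumFin n f ℕ.≤ sumFin n g
sumFin-mono-≤ zero    f≤g = z≤n
sumFin-mono-≤ (suc n) f≤g = ℕₚ.+-mono-≤ (f≤g fzero) (sumFin-mono-≤ n (λ i → f≤g (fsuc i)))

b2n-∧ : ∀ a b → b2n (a ∧ b) ≡ b2n a ℕ.* b2n b
b2n-∧ false b = refl
b2n-∧ true  b = sym (ℕₚ.+-identityʳ (b2n b))

<⇒<ᵇ≡true : ∀ {m n} → m ℕ.< n → (m <ᵇ n) ≡ true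
<⇒<ᵇ≡true = Equivalence.to T-≡ ∘ ℕₚ.<⇒<ᵇ

≮⇒<ᵇ≡false : ∀ {m n} → ¬ m ℕ.< n → (m <ᵇ n) ≡ false
≮⇒<ᵇ≡false m≮n = ¬-not (m≮n ∘ ℕₚ.<ᵇ⇒< _ _ ∘ Equivalence.from T-≡)

b2n-∧-middle : ∀ a b c → b2n a ℕ.* b2n (b ∧ c) ≡ b2n (b ∧ a ∧ c)
b2n-∧-middle false false c = refl
b2n-∧-middle false true  c = refl
b2n-∧-middle true  b     c = ℕₚ.+-identityʳ _

2*[m+n]≡2*m+n+n : ∀ m n → 2 ℕ.* (m ℕ.+ n) ≡ 2 ℕ.* m ℕ.+ n ℕ.+ n
2*[m+n]≡2*m+n+n = solve-∀

∣∣≡sumFin : ∀ {n} (S : Subset n) → ∣ S ∣ ≡ sumFin n (λ v → b2n (memb S v))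
∣∣≡sumFin []            = refl
∣∣≡sumFin (inside  ∷ S) = cong suc (∣∣≡sumFin S)
∣∣≡sumFin (outside ∷ S) = ∣∣≡sumFin S

memb-∩∁ : ∀ {n} (S T : Subset n) w → memb (S ∩ ∁ T) w ≡ memb S w ∧ not (memb T w)
memb-∩∁ S T w = trans (lookup-zipWith _∧_ w S (∁ T)) (cong (memb S w ∧_) (lookup-map w not T))

memb-remove : ∀ {n} {S : Subset n} {v} → v ∈ S → ∀ w →
  b2n (memb S w) ≡ b2n (memb (S ∩ ∁ ⁅ v ⁆) w) ℕ.+ b2n (memb ⁅ v ⁆ w)
memb-remove {S = S} {v} v∈S w rewrite memb-∩∁ S ⁅ v ⁆ w with memb ⁅ v ⁆ w in w∈⁅v⁆
... | false rewrite ∧-identityʳ (memb S w) = sym (ℕₚ.+-identityʳ _)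
... | true  rewrite x∈⁅y⁆⇒x≡y v (lookup⇒[]= w ⁅ v ⁆ w∈⁅v⁆) | []=⇒lookup v∈S = refl

sumFin-⁅⁆ : ∀ {n} (v : Fin n) (f : Fin n → ℕ) → sumFin n (λ w → b2n (memb ⁅ v ⁆ w) ℕ.* f w) ≡ f v
sumFin-⁅⁆ {suc n} fzero    f = begin
  f fzero ℕ.+ 0 ℕ.+ sumFin n (λ w → b2n (memb ⊥ w) ℕ.* f (fsuc w))
    ≡⟨ cong₂ ℕ._+_ (ℕₚ.+-identityʳ (f fzero)) (trans (sumFin-cong n ⊥-term) (sumFin-zero n)) ⟩
  f fzero ℕ.+ 0
    ≡⟨ ℕₚ.+-identityʳ (f fzero) ⟩
  f fzero ∎
  where
  open ≡-Reasoning
  ⊥-term : ∀ w → b2n (memb ⊥ w) ℕ.* f (fsuc w) ≡ 0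
  ⊥-term w = cong (λ b → b2n b ℕ.* f (fsuc w)) (lookup-replicate w outside)
sumFin-⁅⁆ {suc n} (fsuc v) f = sumFin-⁅⁆ v (λ w → f (fsuc w))

∣∣-remove : ∀ {n} {S : Subset n} {v} → v ∈ S → ∣ S ∣ ≡ ∣ S ∩ ∁ ⁅ v ⁆ ∣ ℕ.+ 1
∣∣-remove {n} {S} {v} v∈S = begin
  ∣ S ∣
    ≡⟨ ∣∣≡sumFin S ⟩
  sumFin n (λ w → b2n (memb S w))
    ≡⟨ sumFin-cong n (memb-remove v∈S) ⟩
  sumFin n (λ w → b2n (memb S′ w) ℕ.+ b2n (memb ⁅ v ⁆ w))
    ≡⟨ sumFin-distrib-+ n _ _ ⟩
  sumFin n (λ w → b2n (memb S′ w)) ℕ.+ sumFin n (λ w → b2n (memb ⁅ v ⁆ w))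
    ≡⟨ cong₂ ℕ._+_ (∣∣≡sumFin S′) (∣∣≡sumFin ⁅ v ⁆) ⟨
  ∣ S′ ∣ ℕ.+ ∣ ⁅ v ⁆ ∣
    ≡⟨ cong (∣ S′ ∣ ℕ.+_) (∣⁅x⁆∣≡1 v) ⟩
  ∣ S′ ∣ ℕ.+ 1 ∎
  where
  open ≡-Reasoning
  S′ : Subset n
  S′ = S ∩ ∁ ⁅ v ⁆

∣∣≡0⇒≡⊥ : ∀ {n} {S : Subset n} → ∣ S ∣ ≡ 0 → S ≡ ⊥
∣∣≡0⇒≡⊥ {S = S} ∣S∣≡0 = Empty-unique λ (v , v∈S) →
  ℕₚ.m+1+n≢0 ∣ S ∩ ∁ ⁅ v ⁆ ∣ (trans (sym (∣∣-remove v∈S)) ∣S∣≡0)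

⊆⇒b2n-≤ : ∀ {n} {S T : Subset n} → S ⊆ T → ∀ v → b2n (memb S v) ℕ.≤ b2n (memb T v)
⊆⇒b2n-≤ {S = S} {T} S⊆T v with memb S v in eq
... | false = z≤n
... | true  rewrite []=⇒lookup (S⊆T (lookup⇒[]= v S eq)) = ℕₚ.≤-refl

fromℕ : ℕ → ℚ
fromℕ m = ℤ.+ m / 1

toℚᵘ-fromℕ : ∀ m → toℚᵘ (fromℕ m) ℚᵘ.≃ mkℚᵘ (ℤ.+ m) 0
toℚᵘ-fromℕ m = toℚᵘ-fromℚᵘ (mkℚᵘ (ℤ.+ m) 0)

fromℕ-+ : ∀ m n → fromℕ (m ℕ.+ n) ≡ fromℕ m + fromℕ n
fromℕ-+ m n = toℚᵘ-injective (begin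
  toℚᵘ (fromℕ (m ℕ.+ n))               ≈⟨ toℚᵘ-fromℕ (m ℕ.+ n) ⟩
  mkℚᵘ (ℤ.+ (m ℕ.+ n)) 0                 ≈⟨ ℚᵘ.*≡* numerators ⟩
  mkℚᵘ (ℤ.+ m) 0 ℚᵘ.+ mkℚᵘ (ℤ.+ n) 0       ≈⟨ ℚᵘ.+-cong (toℚᵘ-fromℕ m) (toℚᵘ-fromℕ n) ⟨
  toℚᵘ (fromℕ m) ℚᵘ.+ toℚᵘ (fromℕ n)   ≈⟨ toℚᵘ-homo-+ (fromℕ m) (fromℕ n) ⟨
  toℚᵘ (fromℕ m + fromℕ n)             ∎)
  where
  open ℚᵘ.≃-Reasoning
  numerators : ℤ.+ (m ℕ.+ n) ℤ.* ℤ.1ℤ ≡ (ℤ.+ m ℤ.* ℤ.1ℤ ℤ.+ ℤ.+ n ℤ.* ℤ.1ℤ) ℤ.* ℤ.1ℤ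
  numerators = trans (ℤₚ.*-identityʳ _) (sym (trans (ℤₚ.*-identityʳ _)
                 (cong₂ ℤ._+_ (ℤₚ.*-identityʳ (ℤ.+ m)) (ℤₚ.*-identityʳ (ℤ.+ n)))))

ratio-*-fromℕ : ∀ e k → ratio e (suc k) * fromℕ (suc k) ≡ fromℕ e
ratio-*-fromℕ e k = toℚᵘ-injective (begin
  toℚᵘ (ratio e (suc k) * fromℕ (suc k))            ≈⟨ toℚᵘ-homo-* (ratio e (suc k)) (fromℕ (suc k)) ⟩
  toℚᵘ (ratio e (suc k)) ℚᵘ.* toℚᵘ (fromℕ (suc k))  ≈⟨ ℚᵘ.*-cong (toℚᵘ-fromℚᵘ (mkℚᵘ (ℤ.+ e) k)) (toℚᵘ-fromℕ (suc k)) ⟩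
  mkℚᵘ (ℤ.+ e) k ℚᵘ.* mkℚᵘ (ℤ.+ suc k) 0                ≈⟨ ℚᵘ.*≡* numerators ⟩
  mkℚᵘ (ℤ.+ e) 0                                      ≈⟨ toℚᵘ-fromℕ e ⟨
  toℚᵘ (fromℕ e)                                    ∎)
  where
  open ℚᵘ.≃-Reasoning
  numerators : (ℤ.+ e ℤ.* ℤ.+ suc k) ℤ.* ℤ.1ℤ ≡ ℤ.+ e ℤ.* ℤ.+ (suc k ℕ.* 1)
  numerators = trans (ℤₚ.*-identityʳ _) (cong (λ x → ℤ.+ e ℤ.* ℤ.+ x) (sym (ℕₚ.*-identityʳ (suc k))))

fromℕ-nonNeg : ∀ m → 0ℚ ≤ fromℕ m
fromℕ-nonNeg m = nonNegative⁻¹ (fromℕ m) {{normalize-nonNeg m 1}}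

fromℕ-pos : ∀ m → 0ℚ < fromℕ (suc m)
fromℕ-pos m = positive⁻¹ (fromℕ (suc m)) {{normalize-pos (suc m) 1}}

ratio-nonNeg : ∀ e s → 0ℚ ≤ ratio e s
ratio-nonNeg e zero    = ℚₚ.≤-refl
ratio-nonNeg e (suc k) = nonNegative⁻¹ (ratio e (suc k)) {{normalize-nonNeg e (suc k)}}

fromℕ-mono-≤ : ∀ {m n} → m ℕ.≤ n → fromℕ m ≤ fromℕ n
fromℕ-mono-≤ {m} {n} m≤n = begin
  fromℕ m                        ≡⟨ ℚₚ.+-identityʳ (fromℕ m) ⟨
  fromℕ m + 0ℚ                   ≤⟨ ℚₚ.+-monoʳ-≤ (fromℕ m) (fromℕ-nonNeg (n ℕ.∸ m)) ⟩
  fromℕ m + fromℕ (n ℕ.∸ m)      ≡⟨ fromℕ-+ m (n ℕ.∸ m) ⟨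
  fromℕ (m ℕ.+ (n ℕ.∸ m))        ≡⟨ cong fromℕ (ℕₚ.m+[n∸m]≡n m≤n) ⟩
  fromℕ n                        ∎
  where open ℚₚ.≤-Reasoning

fromℕ-2* : ∀ m → fromℕ (2 ℕ.* m) ≡ (1ℚ + 1ℚ) * fromℕ m
fromℕ-2* m = begin
  fromℕ (2 ℕ.* m)                    ≡⟨ cong (λ x → fromℕ (m ℕ.+ x)) (ℕₚ.+-identityʳ m) ⟩
  fromℕ (m ℕ.+ m)                    ≡⟨ fromℕ-+ m m ⟩
  fromℕ m + fromℕ m                  ≡⟨ cong₂ _+_ (ℚₚ.*-identityˡ (fromℕ m)) (ℚₚ.*-identityˡ (fromℕ m)) ⟨
  1ℚ * fromℕ m + 1ℚ * fromℕ m        ≡⟨ ℚₚ.*-distribʳ-+ (fromℕ m) 1ℚ 1ℚ ⟨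
  (1ℚ + 1ℚ) * fromℕ m                ∎
  where open ≡-Reasoning

+-cancelˡ-≤ : ∀ r {p q} → r + p ≤ r + q → p ≤ q
+-cancelˡ-≤ r {p} {q} r+p≤r+q = begin
  p                 ≡⟨ cancel p ⟨
  - r + (r + p)     ≤⟨ ℚₚ.+-monoʳ-≤ (- r) r+p≤r+q ⟩
  - r + (r + q)     ≡⟨ cancel q ⟩
  q                 ∎
  where
  open ℚₚ.≤-Reasoning
  cancel : ∀ x → - r + (r + x) ≡ x
  cancel x = trans (sym (ℚₚ.+-assoc (- r) r x))
               (trans (cong (_+ x) (ℚₚ.+-inverseˡ r)) (ℚₚ.+-identityˡ x))

*-fromℕ-sumFin-≤ : ∀ q n (g f : Fin n → ℕ) → (∀ i → q * fromℕ (g i) ≤ fromℕ (f i)) →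
  q * fromℕ (sumFin n g) ≤ fromℕ (sumFin n f)
*-fromℕ-sumFin-≤ q zero    g f qg≤f = ℚₚ.≤-reflexive (ℚₚ.*-zeroʳ q)
*-fromℕ-sumFin-≤ q (suc n) g f qg≤f = begin
  q * fromℕ (g fzero ℕ.+ sumFin n (g ∘ fsuc))            ≡⟨ cong (q *_) (fromℕ-+ (g fzero) _) ⟩
  q * (fromℕ (g fzero) + fromℕ (sumFin n (g ∘ fsuc)))    ≡⟨ ℚₚ.*-distribˡ-+ q _ _ ⟩
  q * fromℕ (g fzero) + q * fromℕ (sumFin n (g ∘ fsuc))  ≤⟨ ℚₚ.+-mono-≤ (qg≤f fzero) (*-fromℕ-sumFin-≤ q n _ _ (qg≤f ∘ fsuc)) ⟩
  fromℕ (f fzero) + fromℕ (sumFin n (f ∘ fsuc))          ≡⟨ fromℕ-+ (f fzero) _ ⟨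
  fromℕ (f fzero ℕ.+ sumFin n (f ∘ fsuc))                ∎
  where open ℚₚ.≤-Reasoning

^ℚ-pos : ∀ {b} → 0ℚ < b → ∀ k → 0ℚ < b ^ℚ k
^ℚ-pos b>0 zero    = positive⁻¹ 1ℚ
^ℚ-pos {b} b>0 (suc k) =
  positive⁻¹ (b * b ^ℚ k) {{ℚₚ.pos*pos⇒pos b {{positive b>0}} (b ^ℚ k) {{positive (^ℚ-pos b>0 k)}}}}

geometric-decay : ∀ {b} → 0ℚ < b → (a : ℕ → ℚ) → ∀ K →
  (∀ {m} → m ℕ.< K → b * a (suc m) ≤ a m) → b ^ℚ K * a K ≤ a 0
geometric-decay b>0 a zero    _    = ℚₚ.≤-reflexive (ℚₚ.*-identityˡ (a 0))
geometric-decay {b} b>0 a (suc K) step = begin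
  b * b ^ℚ K * a (suc K)    ≡⟨ cong (_* a (suc K)) (ℚₚ.*-comm b (b ^ℚ K)) ⟩
  b ^ℚ K * b * a (suc K)    ≡⟨ ℚₚ.*-assoc (b ^ℚ K) b (a (suc K)) ⟩
  b ^ℚ K * (b * a (suc K))  ≤⟨ ℚₚ.*-monoˡ-≤-nonNeg (b ^ℚ K) {{nonNegative (ℚₚ.<⇒≤ (^ℚ-pos b>0 K))}} (step (ℕₚ.n<1+n K)) ⟩
  b ^ℚ K * a K              ≤⟨ geometric-decay b>0 a K (step ∘ ℕₚ.m<n⇒m<1+n) ⟩
  a 0                       ∎
  where open ℚₚ.≤-Reasoning

b^[1+k]*m≤b^k⇒m≡0 : ∀ {b} → 1ℚ < b → ∀ k m → b ^ℚ suc k * fromℕ m ≤ b ^ℚ k → m ≡ 0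
b^[1+k]*m≤b^k⇒m≡0     1<b k zero    _ = refl
b^[1+k]*m≤b^k⇒m≡0 {b} 1<b k (suc m) b^[1+k]*m≤b^k =
  contradiction (ℚₚ.<-≤-trans b^k<b^[1+k]*m b^[1+k]*m≤b^k) (ℚₚ.<-irrefl refl)
  where
  b>0 : 0ℚ < b
  b>0 = ℚₚ.<-trans (positive⁻¹ 1ℚ) 1<b
  b^k<b^[1+k]*m : b ^ℚ k < b ^ℚ suc k * fromℕ (suc m)
  b^k<b^[1+k]*m = begin-strict
    b ^ℚ k                        ≡⟨ ℚₚ.*-identityˡ (b ^ℚ k) ⟨
    1ℚ * b ^ℚ k                   <⟨ ℚₚ.*-monoˡ-<-pos (b ^ℚ k) {{positive (^ℚ-pos b>0 k)}} 1<b ⟩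
    b ^ℚ suc k                    ≡⟨ ℚₚ.*-identityʳ (b ^ℚ suc k) ⟨
    b ^ℚ suc k * 1ℚ               ≤⟨ ℚₚ.*-monoˡ-≤-nonNeg (b ^ℚ suc k) {{nonNegative (ℚₚ.<⇒≤ (^ℚ-pos b>0 (suc k)))}} (fromℕ-mono-≤ {1} {suc m} (s≤s z≤n)) ⟩
    b ^ℚ suc k * fromℕ (suc m)    ∎
    where open ℚₚ.≤-Reasoning

*-cancel-<-≤ : ∀ {b R d t s} → 0ℚ ≤ R → 0ℚ < t → b * R < d → d * t ≤ R * s → b * t < s
*-cancel-<-≤ {b} {R} {d} {t} {s} R≥0 t>0 bR<d dt≤Rs =
  ℚₚ.*-cancelˡ-<-nonNeg R {{nonNegative R≥0}} (begin-strict
    R * (b * t)   ≡⟨ ℚₚ.*-assoc R b t ⟨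
    R * b * t     ≡⟨ cong (_* t) (ℚₚ.*-comm R b) ⟩
    b * R * t     <⟨ ℚₚ.*-monoˡ-<-pos t {{positive t>0}} bR<d ⟩
    d * t         ≤⟨ dt≤Rs ⟩
    R * s         ∎)
  where open ℚₚ.≤-Reasoning

module _ {n : ℕ} (G : Graph n) where

  degreeSum : Subset n → ℕ
  degreeSum S = sumFin n (λ u → b2n (memb S u) ℕ.* degIn G u S)

  private
    orientedEdge : Subset n → Fin n → Fin n → ℕ
    orientedEdge S u w = b2n ((toℕ u <ᵇ toℕ w) ∧ adj G u w ∧ memb S u ∧ memb S w)

    -- The incidence (u, w) is the edge {u, w}, counted by edgeCount at its smaller endpoint.
    incidence-split : ∀ S u w →
      b2n (memb S u) ℕ.* b2n (adj G u w ∧ memb S w) ≡ orientedEdge S u w ℕ.+ orientedEdge S w u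
    incidence-split S u w with ℕₚ.<-cmp (toℕ u) (toℕ w)
    ... | tri< u<w _ w≮u rewrite <⇒<ᵇ≡true u<w | ≮⇒<ᵇ≡false w≮u =
      trans (b2n-∧-middle (memb S u) (adj G u w) (memb S w)) (sym (ℕₚ.+-identityʳ _))
    ... | tri> u≮w _ w<u rewrite <⇒<ᵇ≡true w<u | ≮⇒<ᵇ≡false u≮w | adj-sym G w u =
      trans (b2n-∧-middle (memb S u) (adj G u w) (memb S w))
            (cong (λ b → b2n (adj G u w ∧ b)) (∧-comm (memb S u) (memb S w)))
    ... | tri≈ u≮w u≡w _ with toℕ-injective u≡w
    ... | refl rewrite ≮⇒<ᵇ≡false u≮w | adj-irr G u = ℕₚ.*-zeroʳ (b2n (memb S u))

  handshake : ∀ S → degreeSum S ≡ 2 ℕ.* edgeCount G S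
  handshake S = begin
    degreeSum S
      ≡⟨ sumFin-cong n (λ u → *-distribˡ-sumFin n (b2n (memb S u)) _) ⟩
    sumFin n (λ u → sumFin n (λ w → b2n (memb S u) ℕ.* b2n (adj G u w ∧ memb S w)))
      ≡⟨ sumFin-cong n (λ u → trans (sumFin-cong n (incidence-split S u)) (sumFin-distrib-+ n _ _)) ⟩
    sumFin n (λ u → sumFin n (orientedEdge S u) ℕ.+ sumFin n (λ w → orientedEdge S w u))
      ≡⟨ sumFin-distrib-+ n _ _ ⟩
    edgeCount G S ℕ.+ sumFin n (λ u → sumFin n (λ w → orientedEdge S w u))
      ≡⟨ cong (edgeCount G S ℕ.+_) (sumFin-comm n (λ u w → orientedEdge S w u)) ⟩
    edgeCount G S ℕ.+ edgeCount G S
      ≡⟨ cong (edgeCount G S ℕ.+_) (ℕₚ.+-identityʳ (edgeCount G S)) ⟨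
    2 ℕ.* edgeCount G S ∎
    where open ≡-Reasoning

  degIn-remove : ∀ {S v} → v ∈ S → ∀ u →
    degIn G u S ≡ degIn G u (S ∩ ∁ ⁅ v ⁆) ℕ.+ b2n (adj G u v)
  degIn-remove {S} {v} v∈S u = begin
    degIn G u S
      ≡⟨ sumFin-cong n split ⟩
    sumFin n (λ w → b2n (adj G u w ∧ memb S′ w) ℕ.+ b2n (memb ⁅ v ⁆ w) ℕ.* b2n (adj G u w))
      ≡⟨ sumFin-distrib-+ n _ _ ⟩
    degIn G u S′ ℕ.+ sumFin n (λ w → b2n (memb ⁅ v ⁆ w) ℕ.* b2n (adj G u w))
      ≡⟨ cong (degIn G u S′ ℕ.+_) (sumFin-⁅⁆ v (λ w → b2n (adj G u w))) ⟩
    degIn G u S′ ℕ.+ b2n (adj G u v) ∎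
    where
    open ≡-Reasoning
    S′ : Subset n
    S′ = S ∩ ∁ ⁅ v ⁆
    split : ∀ w → b2n (adj G u w ∧ memb S w)
                ≡ b2n (adj G u w ∧ memb S′ w) ℕ.+ b2n (memb ⁅ v ⁆ w) ℕ.* b2n (adj G u w)
    split w = begin
      b2n (adj G u w ∧ memb S w)
        ≡⟨ b2n-∧ (adj G u w) (memb S w) ⟩
      b2n (adj G u w) ℕ.* b2n (memb S w)
        ≡⟨ cong (b2n (adj G u w) ℕ.*_) (memb-remove v∈S w) ⟩
      b2n (adj G u w) ℕ.* (b2n (memb S′ w) ℕ.+ b2n (memb ⁅ v ⁆ w))
        ≡⟨ ℕₚ.*-distribˡ-+ (b2n (adj G u w)) _ _ ⟩
      b2n (adj G u w) ℕ.* b2n (memb S′ w) ℕ.+ b2n (adj G u w) ℕ.* b2n (memb ⁅ v ⁆ w)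
        ≡⟨ cong₂ ℕ._+_ (b2n-∧ (adj G u w) (memb S′ w)) (ℕₚ.*-comm _ (b2n (adj G u w))) ⟨
      b2n (adj G u w ∧ memb S′ w) ℕ.+ b2n (memb ⁅ v ⁆ w) ℕ.* b2n (adj G u w) ∎

  -- v contributes D_v(S) once through its own degree and once through its neighbours' degrees.
  degreeSum-remove : ∀ {S v} → v ∈ S →
    degreeSum S ≡ degreeSum (S ∩ ∁ ⁅ v ⁆) ℕ.+ degIn G v S ℕ.+ degIn G v S
  degreeSum-remove {S} {v} v∈S = begin
    degreeSum S
      ≡⟨ sumFin-cong n split-S ⟩
    sumFin n (λ u → b2n (memb S′ u) ℕ.* degIn G u S ℕ.+ b2n (memb ⁅ v ⁆ u) ℕ.* degIn G u S)
      ≡⟨ sumFin-distrib-+ n _ _ ⟩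
    sumFin n (λ u → b2n (memb S′ u) ℕ.* degIn G u S)
      ℕ.+ sumFin n (λ u → b2n (memb ⁅ v ⁆ u) ℕ.* degIn G u S)
      ≡⟨ cong₂ ℕ._+_ degreeSum-mixed (sumFin-⁅⁆ v (λ u → degIn G u S)) ⟩
    degreeSum S′ ℕ.+ degIn G v S ℕ.+ degIn G v S ∎
    where
    open ≡-Reasoning
    S′ : Subset n
    S′ = S ∩ ∁ ⁅ v ⁆
    split-S : ∀ u → b2n (memb S u) ℕ.* degIn G u S
                  ≡ b2n (memb S′ u) ℕ.* degIn G u S ℕ.+ b2n (memb ⁅ v ⁆ u) ℕ.* degIn G u S
    split-S u = trans (cong (ℕ._* degIn G u S) (memb-remove v∈S u))
                      (ℕₚ.*-distribʳ-+ (degIn G u S) (b2n (memb S′ u)) _)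
    split-degIn : ∀ u → b2n (memb S′ u) ℕ.* degIn G u S
                      ≡ b2n (memb S′ u) ℕ.* degIn G u S′ ℕ.+ b2n (memb S′ u) ℕ.* b2n (adj G u v)
    split-degIn u = trans (cong (b2n (memb S′ u) ℕ.*_) (degIn-remove v∈S u))
                          (ℕₚ.*-distribˡ-+ (b2n (memb S′ u)) (degIn G u S′) _)
    degIn-v : degIn G v S′ ≡ degIn G v S
    degIn-v = sym (begin
      degIn G v S                          ≡⟨ degIn-remove v∈S v ⟩
      degIn G v S′ ℕ.+ b2n (adj G v v)     ≡⟨ cong (λ b → degIn G v S′ ℕ.+ b2n b) (adj-irr G v) ⟩
      degIn G v S′ ℕ.+ 0                   ≡⟨ ℕₚ.+-identityʳ _ ⟩
      degIn G v S′                         ∎)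
    incident-to-v : ∀ u → b2n (memb S′ u) ℕ.* b2n (adj G u v) ≡ b2n (adj G v u ∧ memb S′ u)
    incident-to-v u = begin
      b2n (memb S′ u) ℕ.* b2n (adj G u v)   ≡⟨ ℕₚ.*-comm (b2n (memb S′ u)) _ ⟩
      b2n (adj G u v) ℕ.* b2n (memb S′ u)   ≡⟨ b2n-∧ (adj G u v) (memb S′ u) ⟨
      b2n (adj G u v ∧ memb S′ u)           ≡⟨ cong (λ b → b2n (b ∧ memb S′ u)) (adj-sym G u v) ⟩
      b2n (adj G v u ∧ memb S′ u)           ∎
    degreeSum-mixed : sumFin n (λ u → b2n (memb S′ u) ℕ.* degIn G u S) ≡ degreeSum S′ ℕ.+ degIn G v S
    degreeSum-mixed = begin
      sumFin n (λ u → b2n (memb S′ u) ℕ.* degIn G u S)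
        ≡⟨ sumFin-cong n split-degIn ⟩
      sumFin n (λ u → b2n (memb S′ u) ℕ.* degIn G u S′ ℕ.+ b2n (memb S′ u) ℕ.* b2n (adj G u v))
        ≡⟨ sumFin-distrib-+ n _ _ ⟩
      degreeSum S′ ℕ.+ sumFin n (λ u → b2n (memb S′ u) ℕ.* b2n (adj G u v))
        ≡⟨ cong (degreeSum S′ ℕ.+_) (trans (sumFin-cong n incident-to-v) degIn-v) ⟩
      degreeSum S′ ℕ.+ degIn G v S ∎

  edgeCount-remove : ∀ {S v} → v ∈ S → edgeCount G S ≡ edgeCount G (S ∩ ∁ ⁅ v ⁆) ℕ.+ degIn G v S
  edgeCount-remove {S} {v} v∈S = ℕₚ.*-cancelˡ-≡ _ _ 2 (begin
    2 ℕ.* edgeCount G S                             ≡⟨ handshake S ⟨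
    degreeSum S                                     ≡⟨ degreeSum-remove v∈S ⟩
    degreeSum S′ ℕ.+ degIn G v S ℕ.+ degIn G v S    ≡⟨ cong (λ x → x ℕ.+ degIn G v S ℕ.+ degIn G v S) (handshake S′) ⟩
    2 ℕ.* edgeCount G S′ ℕ.+ degIn G v S ℕ.+ degIn G v S
                                                    ≡⟨ 2*[m+n]≡2*m+n+n (edgeCount G S′) (degIn G v S) ⟨
    2 ℕ.* (edgeCount G S′ ℕ.+ degIn G v S)          ∎)
    where
    open ≡-Reasoning
    S′ : Subset n
    S′ = S ∩ ∁ ⁅ v ⁆

  edgeCount-⊥ : edgeCount G ⊥ ≡ 0
  edgeCount-⊥ = ℕₚ.*-cancelˡ-≡ _ 0 2 (begin
    2 ℕ.* edgeCount G ⊥               ≡⟨ handshake ⊥ ⟨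
    degreeSum ⊥                       ≡⟨ sumFin-cong n (λ u → cong (λ b → b2n b ℕ.* degIn G u ⊥) (lookup-replicate u outside)) ⟩
    sumFin n (λ _ → 0)                ≡⟨ sumFin-zero n ⟩
    0                                 ∎)
    where open ≡-Reasoning

  degIn-mono : ∀ {S T} → S ⊆ T → ∀ v → degIn G v S ℕ.≤ degIn G v T
  degIn-mono {S} {T} S⊆T v = sumFin-mono-≤ n λ u →
    subst₂ ℕ._≤_ (sym (b2n-∧ (adj G v u) (memb S u))) (sym (b2n-∧ (adj G v u) (memb T u)))
      (ℕₚ.*-monoʳ-≤ (b2n (adj G v u)) (⊆⇒b2n-≤ S⊆T u))

  -- Also for S = ∅, where ρ is 0 by the convention a / 0 = 0.
  ρ-*-∣∣ : ∀ S → ρ G S * fromℕ ∣ S ∣ ≡ fromℕ (edgeCount G S)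
  ρ-*-∣∣ S with ∣ S ∣ in ∣S∣≡
  ... | zero  = cong fromℕ (sym (trans (cong (edgeCount G) (∣∣≡0⇒≡⊥ {S = S} ∣S∣≡)) edgeCount-⊥))
  ... | suc s = ratio-*-fromℕ (edgeCount G S) s

  d*∣T∣≤2*edgeCount : ∀ {T S} d → T ⊆ S → (∀ {v} → v ∈ T → d ≤ fromℕ (degIn G v S)) →
    d * fromℕ ∣ T ∣ ≤ (1ℚ + 1ℚ) * fromℕ (edgeCount G S)
  d*∣T∣≤2*edgeCount {T} {S} d T⊆S high = begin
    d * fromℕ ∣ T ∣
      ≡⟨ cong (λ x → d * fromℕ x) (∣∣≡sumFin T) ⟩
    d * fromℕ (sumFin n (λ u → b2n (memb T u)))
      ≤⟨ *-fromℕ-sumFin-≤ d n _ _ high-in-T ⟩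
    fromℕ (sumFin n (λ u → b2n (memb T u) ℕ.* degIn G u S))
      ≤⟨ fromℕ-mono-≤ (sumFin-mono-≤ n (λ u → ℕₚ.*-monoˡ-≤ (degIn G u S) (⊆⇒b2n-≤ T⊆S u))) ⟩
    fromℕ (degreeSum S)
      ≡⟨ cong fromℕ (handshake S) ⟩
    fromℕ (2 ℕ.* edgeCount G S)
      ≡⟨ fromℕ-2* (edgeCount G S) ⟩
    (1ℚ + 1ℚ) * fromℕ (edgeCount G S) ∎
    where
    open ℚₚ.≤-Reasoning
    high-in-T : ∀ u → d * fromℕ (b2n (memb T u)) ≤ fromℕ (b2n (memb T u) ℕ.* degIn G u S)
    high-in-T u with memb T u in u∈T
    ... | false = ℚₚ.≤-reflexive (ℚₚ.*-zeroʳ d)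
    ... | true  = subst₂ _≤_ (sym (ℚₚ.*-identityʳ d)) (cong fromℕ (sym (ℕₚ.+-identityʳ (degIn G u S))))
                    (high (lookup⇒[]= u T u∈T))

  module _ {dstar : ℚ} (isMax : IsMaxDensity G dstar) where

    maxDensity-nonNeg : 0ℚ ≤ dstar
    maxDensity-nonNeg = let ((S , _ , ρS≡dstar) , _) = isMax in subst (0ℚ ≤_) ρS≡dstar (ratio-nonNeg _ ∣ S ∣)

    ρ≤maxDensity : ∀ S → ρ G S ≤ dstar
    ρ≤maxDensity S with nonempty? S
    ... | yes S≢∅ = proj₂ isMax S S≢∅
    ... | no  S≡∅ = subst (_≤ dstar) (sym ρS≡0) maxDensity-nonNeg
      where
      ρS≡0 : ρ G S ≡ 0ℚ
      ρS≡0 = trans (cong (ρ G) (Empty-unique S≡∅)) (cong (ratio (edgeCount G ⊥)) (∣⊥∣≡0 n))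

    edgeCount≤maxDensity*∣∣ : ∀ S → fromℕ (edgeCount G S) ≤ dstar * fromℕ ∣ S ∣
    edgeCount≤maxDensity*∣∣ S = begin
      fromℕ (edgeCount G S)    ≡⟨ ρ-*-∣∣ S ⟨
      ρ G S * fromℕ ∣ S ∣      ≤⟨ ℚₚ.*-monoʳ-≤-nonNeg (fromℕ ∣ S ∣) {{nonNegative (fromℕ-nonNeg ∣ S ∣)}} (ρ≤maxDensity S) ⟩
      dstar * fromℕ ∣ S ∣         ∎
      where open ℚₚ.≤-Reasoning

    densest⇒minDegree : ∀ {S} → ρ G S ≡ dstar → ∀ {v} → v ∈ S → dstar ≤ fromℕ (degIn G v S)
    densest⇒minDegree {S} ρS≡dstar {v} v∈S = +-cancelˡ-≤ (dstar * fromℕ ∣ S′ ∣) (begin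
      dstar * fromℕ ∣ S′ ∣ + dstar
        ≡⟨ cong (dstar * fromℕ ∣ S′ ∣ +_) (ℚₚ.*-identityʳ dstar) ⟨
      dstar * fromℕ ∣ S′ ∣ + dstar * 1ℚ
        ≡⟨ ℚₚ.*-distribˡ-+ dstar (fromℕ ∣ S′ ∣) 1ℚ ⟨
      dstar * (fromℕ ∣ S′ ∣ + 1ℚ)
        ≡⟨ cong (dstar *_) (trans (cong fromℕ (∣∣-remove v∈S)) (fromℕ-+ ∣ S′ ∣ 1)) ⟨
      dstar * fromℕ ∣ S ∣
        ≡⟨ cong (_* fromℕ ∣ S ∣) ρS≡dstar ⟨
      ρ G S * fromℕ ∣ S ∣
        ≡⟨ ρ-*-∣∣ S ⟩
      fromℕ (edgeCount G S)
        ≡⟨ cong fromℕ (edgeCount-remove v∈S) ⟩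
      fromℕ (edgeCount G S′ ℕ.+ degIn G v S)
        ≡⟨ fromℕ-+ (edgeCount G S′) (degIn G v S) ⟩
      fromℕ (edgeCount G S′) + fromℕ (degIn G v S)
        ≤⟨ ℚₚ.+-monoˡ-≤ (fromℕ (degIn G v S)) (edgeCount≤maxDensity*∣∣ S′) ⟩
      dstar * fromℕ ∣ S′ ∣ + fromℕ (degIn G v S) ∎)
      where
      open ℚₚ.≤-Reasoning
      S′ : Subset n
      S′ = S ∩ ∁ ⁅ v ⁆

-- Levels are indexed from 1 as in the paper: the steps Z_i → Z_{i+1} are i = suc m with m < suc k.
module Peeling {n : ℕ} (G : Graph n) (α d ε : ℚ) (ε>0 : 0ℚ < ε) (k : ℕ) (Z : ℕ → Subset n)
  (Z₁≡V : Z 1 ≡ ⊤)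
  (Z-nested : ∀ i → 1 ℕ.≤ i → i ℕ.< 2 ℕ.+ k → Z (suc i) ⊆ Z i)
  (keeps-high : ∀ i → 1 ℕ.≤ i → i ℕ.< 2 ℕ.+ k → ∀ v → v ∈ Z i →
                  α * d < fromℕ (degIn G v (Z i)) → v ∈ Z (suc i))
  (drops-low : ∀ i → 1 ℕ.≤ i → i ℕ.< 2 ℕ.+ k → ∀ v → v ∈ Z i →
                 fromℕ (degIn G v (Z i)) < d → v ∉ Z (suc i))
  where

  c : ℚ
  c = (1ℚ + 1ℚ) * (1ℚ + ε)

  Sparse : ℕ → Set
  Sparse i = c * ρ G (Z i) < d

  1<1+ε : 1ℚ < 1ℚ + ε
  1<1+ε = subst (_< 1ℚ + ε) (ℚₚ.+-identityʳ 1ℚ) (ℚₚ.+-monoʳ-< 1ℚ ε>0)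

  1+ε>0 : 0ℚ < 1ℚ + ε
  1+ε>0 = ℚₚ.<-trans (positive⁻¹ 1ℚ) 1<1+ε

  c>0 : 0ℚ < c
  c>0 = positive⁻¹ c {{ℚₚ.pos*pos⇒pos (1ℚ + 1ℚ) (1ℚ + ε) {{positive 1+ε>0}}}}

  sparse-if-density-≤ : ∀ {i r} → ρ G (Z i) ≤ r → c * r < d → Sparse i
  sparse-if-density-≤ ρ≤r cr<d =
    ℚₚ.≤-<-trans (ℚₚ.*-monoˡ-≤-nonNeg c {{nonNegative (ℚₚ.<⇒≤ c>0)}} ρ≤r) cr<d

  survivor-degree : ∀ {m} → m ℕ.< suc k → ∀ {v} → v ∈ Z (2 ℕ.+ m) → d ≤ fromℕ (degIn G v (Z (suc m)))
  survivor-degree {m} m<1+k {v} v∈Z = ℚₚ.≮⇒≥ λ low →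
    drops-low (suc m) (s≤s z≤n) (s≤s m<1+k) v (Z-nested (suc m) (s≤s z≤n) (s≤s m<1+k) v∈Z) low v∈Z

  shrinks-when-sparse : ∀ {m} → m ℕ.< suc k → Sparse (suc m) →
    (1ℚ + ε) * fromℕ ∣ Z (2 ℕ.+ m) ∣ ≤ fromℕ ∣ Z (suc m) ∣
  shrinks-when-sparse {m} m<1+k sparse with ∣ Z (2 ℕ.+ m) ∣ in ∣T∣≡
  ... | zero  = ℚₚ.≤-trans (ℚₚ.≤-reflexive (ℚₚ.*-zeroʳ (1ℚ + ε))) (fromℕ-nonNeg ∣ Z (suc m) ∣)
  ... | suc t = ℚₚ.<⇒≤ (*-cancel-<-≤ {1ℚ + ε} {R} {d} {fromℕ (suc t)} {fromℕ ∣ S ∣} R≥0 (fromℕ-pos t) bR<d dt≤Rs)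
    where
    open ℚₚ.≤-Reasoning
    S : Subset n
    S = Z (suc m)
    R : ℚ
    R = (1ℚ + 1ℚ) * ρ G S
    R≥0 : 0ℚ ≤ R
    R≥0 = nonNegative⁻¹ R {{ℚₚ.nonNeg*nonNeg⇒nonNeg (1ℚ + 1ℚ) (ρ G S) {{nonNegative (ratio-nonNeg _ ∣ S ∣)}}}}
    bR<d : (1ℚ + ε) * R < d
    bR<d = begin-strict
      (1ℚ + ε) * ((1ℚ + 1ℚ) * ρ G S)   ≡⟨ ℚₚ.*-assoc (1ℚ + ε) (1ℚ + 1ℚ) (ρ G S) ⟨
      (1ℚ + ε) * (1ℚ + 1ℚ) * ρ G S     ≡⟨ cong (_* ρ G S) (ℚₚ.*-comm (1ℚ + ε) (1ℚ + 1ℚ)) ⟩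
      c * ρ G S                         <⟨ sparse ⟩
      d                                 ∎
    dt≤Rs : d * fromℕ (suc t) ≤ R * fromℕ ∣ S ∣
    dt≤Rs = begin
      d * fromℕ (suc t)                     ≡⟨ cong (λ x → d * fromℕ x) ∣T∣≡ ⟨
      d * fromℕ ∣ Z (2 ℕ.+ m) ∣             ≤⟨ d*∣T∣≤2*edgeCount G d (Z-nested (suc m) (s≤s z≤n) (s≤s m<1+k)) (survivor-degree m<1+k) ⟩
      (1ℚ + 1ℚ) * fromℕ (edgeCount G S)     ≡⟨ cong ((1ℚ + 1ℚ) *_) (ρ-*-∣∣ G S) ⟨
      (1ℚ + 1ℚ) * (ρ G S * fromℕ ∣ S ∣)     ≡⟨ ℚₚ.*-assoc (1ℚ + 1ℚ) (ρ G S) (fromℕ ∣ S ∣) ⟨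
      R * fromℕ ∣ S ∣                       ∎

  vanishes-if-all-sparse : IsCeilLog (1ℚ + ε) n k → (∀ {m} → m ℕ.< suc k → Sparse (suc m)) → Z (2 ℕ.+ k) ≡ ⊥
  vanishes-if-all-sparse (n≤b^k , _) sparse =
    ∣∣≡0⇒≡⊥ (b^[1+k]*m≤b^k⇒m≡0 1<1+ε k ∣ Z (2 ℕ.+ k) ∣ (begin
      (1ℚ + ε) ^ℚ suc k * fromℕ ∣ Z (2 ℕ.+ k) ∣
        ≤⟨ geometric-decay 1+ε>0 (λ m → fromℕ ∣ Z (suc m) ∣) (suc k)
             (λ m<1+k → shrinks-when-sparse m<1+k (sparse m<1+k)) ⟩
      fromℕ ∣ Z 1 ∣    ≡⟨ cong (λ S → fromℕ ∣ S ∣) Z₁≡V ⟩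
      fromℕ ∣ ⊤ {n} ∣  ≡⟨ cong fromℕ (∣⊤∣≡n n) ⟩
      fromℕ n          ≤⟨ n≤b^k ⟩
      (1ℚ + ε) ^ℚ k    ∎))
    where open ℚₚ.≤-Reasoning

  high-degree-core-survives : ∀ {S} → (∀ {v} → v ∈ S → α * d < fromℕ (degIn G v S)) →
    ∀ {m} → m ℕ.≤ suc k → S ⊆ Z (suc m)
  high-degree-core-survives high {zero}  _        _   = subst (_ ∈_) (sym Z₁≡V) ∈⊤
  high-degree-core-survives {S} high {suc m} 1+m≤1+k {v} v∈S =
    keeps-high (suc m) (s≤s z≤n) (s≤s 1+m≤1+k) v (S⊆Z v∈S)
      (ℚₚ.<-≤-trans (high v∈S) (fromℕ-mono-≤ (degIn-mono G S⊆Z v)))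
    where
    S⊆Z : S ⊆ Z (suc m)
    S⊆Z = high-degree-core-survives high (ℕₚ.<⇒≤ 1+m≤1+k)

  dense-level-exists : IsCeilLog (1ℚ + ε) n k → Nonempty (Z (2 ℕ.+ k)) →
    ∃ λ j → 1 ℕ.≤ j × j ℕ.< 2 ℕ.+ k × d ≤ c * ρ G (Z j)
  dense-level-exists clog (v , v∈Z) with ℕₚ.anyUpTo? (λ m → d ℚₚ.≤? c * ρ G (Z (suc m))) (suc k)
  ... | yes (m , m<1+k , dense) = suc m , s≤s z≤n , s≤s m<1+k , dense
  ... | no  ¬dense = contradiction (subst (v ∈_) (vanishes-if-all-sparse clog all-sparse) v∈Z) ∉⊥
    where
    all-sparse : ∀ {m} → m ℕ.< suc k → Sparse (suc m)
    all-sparse {m} m<1+k = ℚₚ.≰⇒> λ dense → ¬dense (m , m<1+k , dense)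

theorem2p6 : (n : ℕ) → 1 ℕ.≤ n → (G : Graph n)
    → (α d ε : ℚ) → 1ℚ ≤ α → 0ℚ ≤ d → 0ℚ < ε → ε < 1ℚ
    → (k : ℕ) → IsCeilLog (1ℚ + ε) n k
    → (dstar : ℚ) → IsMaxDensity G dstar
    → (Z : ℕ → Subset n) → IsDecomposition G α d (2 ℕ.+ k) Z
    → ((1ℚ + 1ℚ) * (1ℚ + ε) * dstar < d → Z (2 ℕ.+ k) ≡ ⊥)
      × (α * d < dstar
         → Nonempty (Z (2 ℕ.+ k))
           × ∃ λ j → 1 ℕ.≤ j × j ℕ.< 2 ℕ.+ k
                × d ≤ (1ℚ + 1ℚ) * (1ℚ + ε) * ρ G (Z j))
theorem2p6 n _ G α d ε _ _ ε>0 _ k clog dstar isMax@((S , (v , v∈S) , ρS≡dstar) , _) Z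
           (Z₁≡V , nested , keeps , drops) =
  vanishing , nonvanishing
  where
  open Peeling G α d ε ε>0 k Z Z₁≡V nested keeps drops

  vanishing : c * dstar < d → Z (2 ℕ.+ k) ≡ ⊥
  vanishing c*dstar<d = vanishes-if-all-sparse clog λ {m} _ →
    sparse-if-density-≤ (ρ≤maxDensity G isMax (Z (suc m))) c*dstar<d

  nonvanishing : α * d < dstar →
    Nonempty (Z (2 ℕ.+ k)) × ∃ λ j → 1 ℕ.≤ j × j ℕ.< 2 ℕ.+ k × d ≤ c * ρ G (Z j)
  nonvanishing αd<dstar = survivor , dense-level-exists clog survivor
    where
    survivor : Nonempty (Z (2 ℕ.+ k))
    survivor = v , high-degree-core-survives
      (λ u∈S → ℚₚ.<-≤-trans αd<dstar (densest⇒minDegree G isMax ρS≡dstar u∈S)) ℕₚ.≤-refl v∈S
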